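{- Fix integers $n,m,k$ such that $n/2\ge m>k>0$. Every communication protocol for the Pattern Matching with Edits problem uses $\Omega(n/m\cdot k\log(m/k))$ bits for $P=\mathtt{0}^m$ and some $T\in\{\mathtt{0},\mathtt{1}\}^n$.
   Context: The Pattern Matching with Edits problem: given a pattern $P$ of length $m$, a text $T$ of length $n$, and an integer threshold $k>0$, output $\mathrm{Occ}^E_k(P,T)=\{i\in[0,n] : \exists j\in[i,n],\ \delta_E(P,T[i..j))\le k\}$, where $T[i..j)=T[i]\cdots T[j-1]$ and $\delta_E$ is the edit (Levenshtein) distance, i.e., the minimum number of character insertions, deletions and substitutions transforming one string into the other. A communication protocol here is one-way: Alice knows the input and sends a message to Bob, who must output $\mathrm{Occ}^E_k(P,T)$ from the message alone; the claim is that for some text $T\in\{\mathtt{0},\mathtt{1}\}^n$ (with $P=\mathtt{0}^m$) the message has $\Omega(n/m\cdot k\log(m/k))$ bits. -}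

module Defs where

open import Data.Nat using (ℕ; zero; suc; _+_; _∸_; _≤_)
open import Data.Bool using (Bool; true; false)
open import Data.List using (List; []; _∷_; take; drop; replicate)
open import Data.Vec using (Vec; toList)
open import Data.Fin using (Fin; toℕ)
open import Data.Product using (∃-syntax; _×_)
open import Relation.Binary.PropositionalEquality using (_≡_; _≢_)
open import Function.Bundles using (_⇔_)

data _⟶[_]_ {A : Set} : List A → ℕ → List A → Set where
  done  : [] ⟶[ 0 ] []
  match : ∀ {x xs ys c} → xs ⟶[ c ] ys → (x ∷ xs) ⟶[ c ] (x ∷ ys)
  subst : ∀ {x y xs ys c} → x ≢ y → xs ⟶[ c ] ys → (x ∷ xs) ⟶[ suc c ] (y ∷ ys)
  del   : ∀ {x xs ys c} → xs ⟶[ c ] ys → (x ∷ xs) ⟶[ suc c ] ys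
  ins   : ∀ {y xs ys c} → xs ⟶[ c ] ys → xs ⟶[ suc c ] (y ∷ ys)

EdDistLe : {A : Set} → List A → List A → ℕ → Set
EdDistLe xs ys k = ∃[ c ] (c ≤ k × xs ⟶[ c ] ys)

fragment : ∀ {n} → Vec Bool n → ℕ → ℕ → List Bool
fragment T i j = take (j ∸ i) (drop i (toList T))

zeros : ℕ → List Bool
zeros m = replicate m false

-- i ∈ Occ^E_k(P, T) for P = 0^m (bit 0 represented by false),
-- with i ∈ [0, n] represented by Fin (suc n)
InOcc : ∀ {n} → ℕ → ℕ → Vec Bool n → Fin (suc n) → Set
InOcc {n} m k T i = ∃[ j ] (toℕ i ≤ j × j ≤ n × EdDistLe (zeros m) (fragment T (toℕ i) j) k)

-- One-way protocol for Pattern Matching with Edits with P = 0^m, texts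
-- T ∈ {0,1}^n and threshold k: Alice (knowing the input) sends the
-- bit string  message T ; Bob, from the message alone, outputs the
-- set Occ^E_k(P,T) ⊆ [0,n] (as a characteristic function).
record Protocol (n m k : ℕ) : Set where
  field
    message : Vec Bool n → List Bool
    output  : List Bool → Fin (suc n) → Bool
    correct : ∀ T i → (output (message T) i ≡ true) ⇔ InOcc m k T i
open Protocol public

-- For P = 0^m a position is an occurrence exactly when the window of length m
-- starting there holds at most k ones: an edit script pays for every one it
-- keeps and for every character the fragment is short of. A hard text is made
-- of N = ⌊n/2m⌋ segments, each two blocks of length m: the one-hot codes of K
-- digits over an alphabet of size 2^e, then the codes of K zero digits, both
-- padded with k − K ones and then zeros. A window starting q positions into a
-- segment loses the ones among the first q characters of the first block and
-- gains those of the second. If two digit matrices first differ in digits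
-- a < b, let q end at offset a of the code of that digit: the window then
-- holds k ones in one text and k + 1 in the other. Hence the 2^(eNK) texts
-- have pairwise distinct occurrence sets and some message has at least eNK
-- bits. Taking 2^e ≈ m/k and K = k when 2k ≤ m, and e = 1 and K = m − k
-- otherwise (where Bernoulli's inequality gives (m/k)^k ≤ 4^(m−k)), yields
-- the bound with d = 8.
module Submission where

open import Defs
open import Data.Bool using (Bool; true; false)
open import Data.Nat
open import Data.Nat.Properties
open import Data.Nat.DivMod using (_/_; _%_; m/n*n≤m; m≡m%n+[m/n]*n; m%n<n; m≥n⇒m/n>0)
open import Data.Nat.Binary using (ℕᵇ; 2[1+_]; 1+[2_]; size)
import Data.Nat.Binary as ℕᵇ
import Data.Nat.Binary.Properties as ℕᵇ
open import Data.Nat.Tactic.RingSolver using (solve-∀)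
open import Algebra.Properties.CommutativeSemigroup *-commutativeSemigroup
  using (interchange; x∙yz≈y∙xz; xy∙z≈y∙xz)
open import Data.List using (List; []; _∷_; _++_; take; drop; length; replicate)
open import Data.List.Properties
  using (length-++; length-++-≤ˡ; length-drop; length-take; length-replicate; take++drop≡id)
open import Data.Fin using (Fin; toℕ; quotient; remainder; combine)
import Data.Fin as Fin
import Data.Fin.Properties as Fin
open import Data.Vec using (Vec; []; _∷_; toList; concat; group)
import Data.Vec as Vec
open import Data.Vec.Properties using (length-toList; toList-cast; toList∘fromList; ∷-injectiveˡ; ∷-injectiveʳ)
open import Data.Vec.Relation.Binary.Lex.Strict using (Lex-<; this; next)
import Data.Vec.Relation.Binary.Lex.Strict as Lex
open import Data.Vec.Relation.Binary.Pointwise.Inductive as Pointwise using (Pointwise; Pointwise-≡⇒≡)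
open import Data.Product using (∃-syntax; _×_; _,_; proj₁; proj₂)
open import Function using (Injective; _∘_)
open import Function.Bundles using (Equivalence)
open import Relation.Binary.Definitions using (Tri; tri<; tri≈; tri>)
open import Relation.Binary.PropositionalEquality hiding (subst)
import Relation.Binary.PropositionalEquality as ≡
open import Relation.Nullary using (¬_; yes; no; contradiction)

module _ {A : Set} where

  take-++-length : ∀ (xs : List A) {ys l} t → length xs ≡ l → take (l + t) (xs ++ ys) ≡ xs ++ take t ys
  take-++-length []       t refl = refl
  take-++-length (x ∷ xs) t refl = cong (x ∷_) (take-++-length xs t refl)

  drop-++-length : ∀ (xs : List A) {ys l} t → length xs ≡ l → drop (l + t) (xs ++ ys) ≡ drop t ys
  drop-++-length []       t refl = refl
  drop-++-length (x ∷ xs) t refl = drop-++-length xs t refl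

  take-++-≤ : ∀ {t} (xs : List A) {ys} → t ≤ length xs → take t (xs ++ ys) ≡ take t xs
  take-++-≤ {zero}  xs       _        = refl
  take-++-≤ {suc t} (x ∷ xs) (s≤s t≤) = cong (x ∷_) (take-++-≤ xs t≤)

  drop-++-≤ : ∀ {t} (xs : List A) {ys} → t ≤ length xs → drop t (xs ++ ys) ≡ drop t xs ++ ys
  drop-++-≤ {zero}  xs       _        = refl
  drop-++-≤ {suc t} (x ∷ xs) (s≤s t≤) = drop-++-≤ xs t≤

  take-drop-++-≤ : ∀ {t l} (xs : List A) {ys} → t + l ≤ length xs →
                   take l (drop t (xs ++ ys)) ≡ take l (drop t xs)
  take-drop-++-≤ {t} {l} xs t+l≤ = trans (cong (take l) (drop-++-≤ xs (m+n≤o⇒m≤o t t+l≤)))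
    (take-++-≤ (drop t xs) (≤-trans (m+n≤o⇒m≤o∸n l (≤-trans (≤-reflexive (+-comm l t)) t+l≤))
                                    (≤-reflexive (sym (length-drop t xs)))))

ones : List Bool → ℕ
ones []           = 0
ones (true ∷ bs)  = suc (ones bs)
ones (false ∷ bs) = ones bs

ones-++ : ∀ xs ys → ones (xs ++ ys) ≡ ones xs + ones ys
ones-++ []           ys = refl
ones-++ (true ∷ xs)  ys = cong suc (ones-++ xs ys)
ones-++ (false ∷ xs) ys = ones-++ xs ys

ones-zeros : ∀ m → ones (zeros m) ≡ 0
ones-zeros zero    = refl
ones-zeros (suc m) = ones-zeros m

ones-ones++zeros : ∀ a b → ones (replicate a true ++ zeros b) ≡ a
ones-ones++zeros zero    b = ones-zeros b
ones-ones++zeros (suc a) b = cong suc (ones-ones++zeros a b)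

length-ones++zeros : ∀ a b → length (replicate a true ++ zeros b) ≡ a + b
length-ones++zeros zero    b = length-replicate b
length-ones++zeros (suc a) b = cong suc (length-ones++zeros a b)

ones-take-zeros : ∀ t s → ones (take t (zeros s)) ≡ 0
ones-take-zeros zero    s       = refl
ones-take-zeros (suc t) zero    = refl
ones-take-zeros (suc t) (suc s) = ones-take-zeros t s

ones≤ones-∷ : ∀ x xs → ones xs ≤ ones (x ∷ xs)
ones≤ones-∷ true  xs = n≤1+n (ones xs)
ones≤ones-∷ false xs = ≤-refl

ones-∷≤1+ones : ∀ x xs → ones (x ∷ xs) ≤ suc (ones xs)
ones-∷≤1+ones true  xs = ≤-refl
ones-∷≤1+ones false xs = n≤1+n (ones xs)

ones≤length : ∀ xs → ones xs ≤ length xs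
ones≤length []           = z≤n
ones≤length (true ∷ xs)  = s≤s (ones≤length xs)
ones≤length (false ∷ xs) = m≤n⇒m≤1+n (ones≤length xs)

ones-take+ones-drop : ∀ t xs → ones (take t xs) + ones (drop t xs) ≡ ones xs
ones-take+ones-drop t xs = trans (sym (ones-++ (take t xs) (drop t xs))) (cong ones (take++drop≡id t xs))

ones-take-≤ : ∀ m ℓ xs → ones (take m xs) ≤ ones (take ℓ xs) + (m ∸ length (take ℓ xs))
ones-take-≤ zero    ℓ       xs           = z≤n
ones-take-≤ (suc m) zero    xs           = begin
  ones (take (suc m) xs)   ≤⟨ ones≤length (take (suc m) xs) ⟩
  length (take (suc m) xs) ≡⟨ length-take (suc m) xs ⟩
  suc m ⊓ length xs        ≤⟨ m⊓n≤m (suc m) (length xs) ⟩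
  suc m                    ∎
  where open ≤-Reasoning
ones-take-≤ (suc m) (suc ℓ) []           = z≤n
ones-take-≤ (suc m) (suc ℓ) (true ∷ xs)  = s≤s (ones-take-≤ m ℓ xs)
ones-take-≤ (suc m) (suc ℓ) (false ∷ xs) = ones-take-≤ m ℓ xs

ones-slide : ∀ {q} xs ys → q ≤ length xs →
             ones (take (length xs) (drop q (xs ++ ys))) + ones (take q xs) ≡ ones xs + ones (take q ys)
ones-slide {q} xs ys q≤ = begin
  ones (take (length xs) (drop q (xs ++ ys))) + ones (take q xs) ≡⟨ cong (λ w → ones w + ones (take q xs)) slid ⟩
  ones (drop q xs ++ take q ys) + ones (take q xs)               ≡⟨ cong (_+ ones (take q xs)) (ones-++ (drop q xs) (take q ys)) ⟩
  ones (drop q xs) + ones (take q ys) + ones (take q xs)         ≡⟨ +-comm _ (ones (take q xs)) ⟩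
  ones (take q xs) + (ones (drop q xs) + ones (take q ys))       ≡⟨ +-assoc (ones (take q xs)) _ _ ⟨
  ones (take q xs) + ones (drop q xs) + ones (take q ys)         ≡⟨ cong (_+ ones (take q ys)) (ones-take+ones-drop q xs) ⟩
  ones xs + ones (take q ys)                                     ∎
  where
  open ≡-Reasoning
  slid : take (length xs) (drop q (xs ++ ys)) ≡ drop q xs ++ take q ys
  slid = begin
    take (length xs) (drop q (xs ++ ys))            ≡⟨ cong₂ take (sym length-drop+q) (drop-++-≤ xs q≤) ⟩
    take (length (drop q xs) + q) (drop q xs ++ ys) ≡⟨ take-++-length (drop q xs) q refl ⟩
    drop q xs ++ take q ys                          ∎
    where
    length-drop+q : length (drop q xs) + q ≡ length xs
    length-drop+q = trans (cong (_+ q) (length-drop q xs)) (m∸n+n≡m q≤)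

-- Edit distance to 0^m

suc-∸-≤ : ∀ m n → suc m ∸ n ≤ suc (m ∸ n)
suc-∸-≤ m       zero    = ≤-refl
suc-∸-≤ zero    (suc n) = ≤-trans (m∸n≤m 1 (suc n)) (s≤s z≤n)
suc-∸-≤ (suc m) (suc n) = suc-∸-≤ m n

-- Each edit raises ones ys + (length xs ∸ length ys) − ones xs by at most one.
ones-cost : ∀ {xs c ys} → xs ⟶[ c ] ys → ones ys + (length xs ∸ length ys) ≤ c + ones xs
ones-cost done                            = z≤n
ones-cost (match {true} {c = c} e)        = ≤-trans (s≤s (ones-cost e)) (≤-reflexive (sym (+-suc c _)))
ones-cost (match {false} e)               = ones-cost e
ones-cost (subst {true}  {true}  t≢t _)   = contradiction refl t≢t
ones-cost (subst {true}  {false} _   e)   = m≤n⇒m≤1+n (≤-trans (ones-cost e) (+-monoʳ-≤ _ (n≤1+n _)))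
ones-cost (subst {false} {true}  _   e)   = s≤s (ones-cost e)
ones-cost (subst {false} {false} f≢f _)   = contradiction refl f≢f
ones-cost (del {x} {xs} {ys} {c} e)       = begin
  ones ys + (suc (length xs) ∸ length ys) ≤⟨ +-monoʳ-≤ (ones ys) (suc-∸-≤ (length xs) (length ys)) ⟩
  ones ys + suc (length xs ∸ length ys)   ≡⟨ +-suc (ones ys) _ ⟩
  suc (ones ys + (length xs ∸ length ys)) ≤⟨ s≤s (ones-cost e) ⟩
  suc c + ones xs                         ≤⟨ +-monoʳ-≤ (suc c) (ones≤ones-∷ x xs) ⟩
  suc c + ones (x ∷ xs)                   ∎
  where open ≤-Reasoning
ones-cost (ins {y} {xs} {ys} {c} e)       = begin
  ones (y ∷ ys) + (length xs ∸ suc (length ys)) ≤⟨ +-mono-≤ (ones-∷≤1+ones y ys) (∸-monoʳ-≤ (length xs) (n≤1+n _)) ⟩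
  suc (ones ys) + (length xs ∸ length ys)       ≤⟨ s≤s (ones-cost e) ⟩
  suc c + ones xs                               ∎
  where open ≤-Reasoning

zeros-cost : ∀ {m c ys} → zeros m ⟶[ c ] ys → ones ys + (m ∸ length ys) ≤ c
zeros-cost {m} {c} {ys} e = begin
  ones ys + (m ∸ length ys)                ≡⟨ cong (λ l → ones ys + (l ∸ length ys)) (length-replicate m) ⟨
  ones ys + (length (zeros m) ∸ length ys) ≤⟨ ones-cost e ⟩
  c + ones (zeros m)                       ≡⟨ cong (c +_) (ones-zeros m) ⟩
  c + 0                                    ≡⟨ +-identityʳ c ⟩
  c                                        ∎
  where open ≤-Reasoning

zeros-script : ∀ ys → zeros (length ys) ⟶[ ones ys ] ys
zeros-script []           = done
zeros-script (true ∷ ys)  = subst (λ ()) (zeros-script ys)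
zeros-script (false ∷ ys) = match (zeros-script ys)

module _ {n : ℕ} (m k : ℕ) (T : Vec Bool n) (i : Fin (suc n)) where

  private
    window : List Bool
    window = take m (drop (toℕ i) (toList T))

  InOcc⇒ones≤ : InOcc m k T i → ones window ≤ k
  InOcc⇒ones≤ (j , _ , _ , c , c≤k , e) = begin
    ones window                                   ≤⟨ ones-take-≤ m (j ∸ toℕ i) _ ⟩
    ones F + (m ∸ length F)                       ≤⟨ zeros-cost e ⟩
    c                                             ≤⟨ c≤k ⟩
    k                                             ∎
    where
    open ≤-Reasoning
    F = fragment T (toℕ i) j

  ones≤⇒InOcc : toℕ i + m ≤ n → ones window ≤ k → InOcc m k T i
  ones≤⇒InOcc fits w≤k = toℕ i + m , m≤m+n (toℕ i) m , fits , ones window , w≤k , e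
    where
    length-window : length window ≡ m
    length-window = begin
      length window                        ≡⟨ length-take m _ ⟩
      m ⊓ length (drop (toℕ i) (toList T)) ≡⟨ cong (m ⊓_) (length-drop (toℕ i) (toList T)) ⟩
      m ⊓ (length (toList T) ∸ toℕ i)      ≡⟨ cong (λ l → m ⊓ (l ∸ toℕ i)) (length-toList T) ⟩
      m ⊓ (n ∸ toℕ i)                      ≡⟨ m≤n⇒m⊓n≡m m≤n∸i ⟩
      m                                    ∎
      where
      open ≡-Reasoning
      m≤n∸i : m ≤ n ∸ toℕ i
      m≤n∸i = m+n≤o⇒m≤o∸n m (≤-trans (≤-reflexive (+-comm m (toℕ i))) fits)
    e : zeros m ⟶[ ones window ] fragment T (toℕ i) (toℕ i + m)
    e = ≡.subst₂ (λ l F → zeros l ⟶[ ones window ] F) length-window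
          (cong (λ j → take j (drop (toℕ i) (toList T))) (sym (m+n∸m≡n (toℕ i) m)))
          (zeros-script window)

Occ-separated⇒message≢ : ∀ {n m k} (Π : Protocol n m k) {T T′ : Vec Bool n} →
                         ∃[ i ] (InOcc m k T i × ¬ InOcc m k T′ i) → message Π T ≢ message Π T′
Occ-separated⇒message≢ Π {T} {T′} (i , occ , ¬occ′) same = ¬occ′ (Equivalence.to (correct Π T′ i)
  (trans (cong (λ M → output Π M i) (sym same)) (Equivalence.from (correct Π T i) occ)))

-- Short messages are few

toBinary : List Bool → ℕᵇ
toBinary []           = ℕᵇ.zero
toBinary (false ∷ bs) = 1+[2 toBinary bs ]
toBinary (true ∷ bs)  = 2[1+ toBinary bs ]

toBinary-injective : Injective _≡_ _≡_ toBinary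
toBinary-injective {[]}         {[]}         _  = refl
toBinary-injective {false ∷ bs} {false ∷ cs} eq = cong (false ∷_) (toBinary-injective (ℕᵇ.1+[2_]-injective eq))
toBinary-injective {true ∷ bs}  {true ∷ cs}  eq = cong (true ∷_) (toBinary-injective (ℕᵇ.2[1+_]-injective eq))
toBinary-injective {[]}         {false ∷ _}  ()
toBinary-injective {[]}         {true ∷ _}   ()
toBinary-injective {false ∷ _}  {[]}         ()
toBinary-injective {false ∷ _}  {true ∷ _}   ()
toBinary-injective {true ∷ _}   {[]}         ()
toBinary-injective {true ∷ _}   {false ∷ _}  ()

size-toBinary : ∀ bs → size (toBinary bs) ≡ length bs
size-toBinary []           = refl
size-toBinary (false ∷ bs) = cong suc (size-toBinary bs)
size-toBinary (true ∷ bs)  = cong suc (size-toBinary bs)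

1+toℕ<2^[1+size] : ∀ x → suc (ℕᵇ.toℕ x) < 2 ^ suc (size x)
1+toℕ<2^[1+size] ℕᵇ.zero  = ≤-refl
1+toℕ<2^[1+size] 2[1+ x ] = begin
  2 + 2 * suc (ℕᵇ.toℕ x)   ≡⟨ *-suc 2 (suc (ℕᵇ.toℕ x)) ⟨
  2 * suc (suc (ℕᵇ.toℕ x)) ≤⟨ *-monoʳ-≤ 2 (1+toℕ<2^[1+size] x) ⟩
  2 * 2 ^ suc (size x)     ∎
  where open ≤-Reasoning
1+toℕ<2^[1+size] 1+[2 x ] = begin
  3 + 2 * ℕᵇ.toℕ x         <⟨ n<1+n _ ⟩
  2 + (2 + 2 * ℕᵇ.toℕ x)   ≡⟨ trans (*-suc 2 (suc (ℕᵇ.toℕ x))) (cong (2 +_) (*-suc 2 (ℕᵇ.toℕ x))) ⟨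
  2 * suc (suc (ℕᵇ.toℕ x)) ≤⟨ *-monoʳ-≤ 2 (1+toℕ<2^[1+size] x) ⟩
  2 * 2 ^ suc (size x)     ∎
  where open ≤-Reasoning

module _ {N : ℕ} (L : ℕ) (F : Fin N → List Bool) (F-injective : Injective _≡_ _≡_ F) (2^L≤N : 2 ^ L ≤ N) where

  private
    instance
      2^L≢0 : NonZero (2 ^ L)
      2^L≢0 = m^n≢0 2 L

    rank : List Bool → ℕ
    rank = ℕᵇ.toℕ ∘ toBinary

    -- There are only 2^L − 1 words shorter than L.
    rank<pred[2^L] : ∀ bs → length bs < L → rank bs < pred (2 ^ L)
    rank<pred[2^L] bs |bs|<L = <⇒≤pred (begin
      suc (suc (rank bs))          ≤⟨ 1+toℕ<2^[1+size] (toBinary bs) ⟩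
      2 ^ suc (size (toBinary bs)) ≡⟨ cong (λ l → 2 ^ suc l) (size-toBinary bs) ⟩
      2 ^ suc (length bs)          ≤⟨ ^-monoʳ-≤ 2 |bs|<L ⟩
      2 ^ L                        ∎)
      where open ≤-Reasoning

    ¬all-short : ¬ (∀ i → length (F i) < L)
    ¬all-short all-short with Fin.pigeonhole pred[2^L]<N (λ i → Fin.fromℕ< (rank<pred[2^L] (F i) (all-short i)))
      where
      pred[2^L]<N : pred (2 ^ L) < N
      pred[2^L]<N = ≤-trans (≤-reflexive (suc-pred (2 ^ L))) 2^L≤N
    ... | i , j , i<j , same-rank = Fin.<-irrefl (F-injective (toBinary-injective (ℕᵇ.toℕ-injective ranks))) i<j
      where
      ranks : rank (F i) ≡ rank (F j)
      ranks = trans (sym (Fin.toℕ-fromℕ< _)) (trans (cong toℕ same-rank) (Fin.toℕ-fromℕ< _))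

  injective⇒long-word : ∃[ i ] L ≤ length (F i)
  injective⇒long-word with Fin.¬∀⟶∃¬ N (λ i → length (F i) < L) (λ i → length (F i) <? L) ¬all-short
  ... | i , ¬short = i , ≮⇒≥ ¬short

digits : ∀ {s} K → Fin (s ^ K) → Vec (Fin s) K
digits     zero    _ = []
digits {s} (suc K) i = quotient (s ^ K) i ∷ digits K (remainder {s} (s ^ K) i)

digits-injective : ∀ {s} K → Injective _≡_ _≡_ (digits {s} K)
digits-injective     zero    {Fin.zero} {Fin.zero} _  = refl
digits-injective {s} (suc K) {i}        {j}        eq = begin
  i                                                          ≡⟨ Fin.combine-remQuot {s} (s ^ K) i ⟨
  combine (quotient {s} (s ^ K) i) (remainder {s} (s ^ K) i) ≡⟨ cong₂ combine (∷-injectiveˡ eq)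
                                                                              (digits-injective K (∷-injectiveʳ eq)) ⟩
  combine (quotient {s} (s ^ K) j) (remainder {s} (s ^ K) j) ≡⟨ Fin.combine-remQuot {s} (s ^ K) j ⟩
  j                                                          ∎
  where open ≡-Reasoning

digitMatrix : ∀ {s} N K → Fin (s ^ (N * K)) → Vec (Vec (Fin s) K) N
digitMatrix N K = proj₁ ∘ group N K ∘ digits (N * K)

digitMatrix-injective : ∀ {s} N K → Injective _≡_ _≡_ (digitMatrix {s} N K)
digitMatrix-injective N K eq = digits-injective (N * K)
  (trans (proj₂ (group N K _)) (trans (cong concat eq) (sym (proj₂ (group N K _)))))

oneHot : ∀ {s} → Fin s → List Bool
oneHot {suc s} Fin.zero    = true ∷ zeros s
oneHot         (Fin.suc a) = false ∷ oneHot a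

length-oneHot : ∀ {s} (a : Fin s) → length (oneHot a) ≡ s
length-oneHot {suc s} Fin.zero    = cong suc (length-replicate s)
length-oneHot         (Fin.suc a) = cong suc (length-oneHot a)

ones-oneHot : ∀ {s} (a : Fin s) → ones (oneHot a) ≡ 1
ones-oneHot {suc s} Fin.zero    = cong suc (ones-zeros s)
ones-oneHot         (Fin.suc a) = ones-oneHot a

ones-take-oneHot-≤ : ∀ {s} {a b : Fin s} → b Fin.≤ a → ones (take (suc (toℕ a)) (oneHot b)) ≡ 1
ones-take-oneHot-≤ {suc s} {a}     {Fin.zero}      _   = cong suc (ones-take-zeros (toℕ a) s)
ones-take-oneHot-≤ {a = Fin.suc a} {b = Fin.suc b} b≤a = ones-take-oneHot-≤ (s≤s⁻¹ b≤a)

ones-take-oneHot-< : ∀ {s} {a b : Fin s} → a Fin.< b → ones (take (suc (toℕ a)) (oneHot b)) ≡ 0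
ones-take-oneHot-< {a = Fin.zero}  {b = Fin.suc b} _   = refl
ones-take-oneHot-< {a = Fin.suc a} {b = Fin.suc b} a<b = ones-take-oneHot-< (s<s⁻¹ a<b)

code : ∀ {s K} → Vec (Fin s) K → List Bool
code []       = []
code (a ∷ as) = oneHot a ++ code as

length-code : ∀ {s K} (as : Vec (Fin s) K) → length (code as) ≡ K * s
length-code []       = refl
length-code (a ∷ as) = trans (length-++ (oneHot a)) (cong₂ _+_ (length-oneHot a) (length-code as))

ones-code : ∀ {s K} (as : Vec (Fin s) K) → ones (code as) ≡ K
ones-code []       = refl
ones-code (a ∷ as) = trans (ones-++ (oneHot a) (code as)) (cong₂ _+_ (ones-oneHot a) (ones-code as))

ones-take-code-∷ : ∀ {s K} (a : Fin s) (as : Vec (Fin s) K) t →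
                   ones (take (s + t) (code (a ∷ as))) ≡ suc (ones (take t (code as)))
ones-take-code-∷ {s} a as t = begin
  ones (take (s + t) (oneHot a ++ code as)) ≡⟨ cong ones (take-++-length (oneHot a) t (length-oneHot a)) ⟩
  ones (oneHot a ++ take t (code as))       ≡⟨ ones-++ (oneHot a) _ ⟩
  ones (oneHot a) + ones (take t (code as)) ≡⟨ cong (_+ _) (ones-oneHot a) ⟩
  suc (ones (take t (code as)))             ∎
  where open ≡-Reasoning

module _ {s : ℕ} where

  _≺_ : ∀ {K} → Vec (Fin (suc s)) K → Vec (Fin (suc s)) K → Set
  _≺_ = Lex-< _≡_ Fin._<_

  allZero : ∀ K → Vec (Fin (suc s)) K
  allZero K = Vec.replicate K Fin.zero

  separating-prefix : ∀ {K} {x y : Vec (Fin (suc s)) K} → x ≺ y →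
    ∃[ q ] (q ≤ K * suc s × ones (take q (code x)) ≡ ones (take q (code (allZero K)))
                          × suc (ones (take q (code y))) ≡ ones (take q (code (allZero K))))
  separating-prefix {suc K} (this {a} {b} {xs = xs} {ys} a<b _) =
    suc (toℕ a) , ≤-trans (Fin.toℕ<n a) (m≤m+n (suc s) (K * suc s)) ,
    trans (digit a xs (Fin.≤-refl {x = a})) (sym (digit Fin.zero (allZero K) z≤n)) ,
    trans (cong suc (trans (prefix b ys) (ones-take-oneHot-< a<b))) (sym (digit Fin.zero (allZero K) z≤n))
    where
    prefix : ∀ c (cs : Vec (Fin (suc s)) K) →
             ones (take (suc (toℕ a)) (code (c ∷ cs))) ≡ ones (take (suc (toℕ a)) (oneHot c))
    prefix c cs = cong ones (take-++-≤ (oneHot c) (≤-trans (Fin.toℕ<n a) (≤-reflexive (sym (length-oneHot c)))))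
    digit : ∀ c cs → c Fin.≤ a → ones (take (suc (toℕ a)) (code (c ∷ cs))) ≡ 1
    digit c cs c≤a = trans (prefix c cs) (ones-take-oneHot-≤ c≤a)
  separating-prefix {suc K} (next {c} {xs = xs} {ys} refl rest) with separating-prefix rest
  ... | q , q≤ , same , one-less =
    suc s + q , +-monoʳ-≤ (suc s) q≤ ,
    trans (ones-take-code-∷ c xs q) (trans (cong suc same) (sym (ones-take-code-∷ Fin.zero (allZero K) q))) ,
    trans (cong suc (ones-take-code-∷ c ys q)) (trans (cong suc one-less) (sym (ones-take-code-∷ Fin.zero (allZero K) q)))

-- The hard texts

module HardTexts {s K m : ℕ} (Z : List Bool) (length-block≡m : K * suc s + length Z ≡ m) where

  Digits : Set
  Digits = Vec (Fin (suc s)) K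

  block : Digits → List Bool
  block x = code x ++ Z

  length-block : ∀ (x : Digits) → length (block x) ≡ m
  length-block x = trans (length-++ (code x)) (trans (cong (_+ length Z) (length-code x)) length-block≡m)

  ones-block : ∀ (x : Digits) → ones (block x) ≡ K + ones Z
  ones-block x = trans (ones-++ (code x) Z) (cong (_+ ones Z) (ones-code x))

  text : ∀ {N} → Vec Digits N → List Bool
  text []       = []
  text (x ∷ xs) = block x ++ block (allZero K) ++ text xs

  length-segment : ∀ (x : Digits) rest → length (block x ++ block (allZero K) ++ rest) ≡ m + (m + length rest)
  length-segment x rest = begin
    length (block x ++ block (allZero K) ++ rest)               ≡⟨ length-++ (block x) ⟩
    length (block x) + length (block (allZero K) ++ rest)       ≡⟨ cong (length (block x) +_) (length-++ (block (allZero K))) ⟩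
    length (block x) + (length (block (allZero K)) + length rest) ≡⟨ cong₂ (λ a b → a + (b + length rest))
                                                                         (length-block x) (length-block (allZero K)) ⟩
    m + (m + length rest)                                      ∎
    where open ≡-Reasoning

  length-text : ∀ {N} (v : Vec Digits N) → length (text v) ≡ N * (m + m)
  length-text []       = refl
  length-text (x ∷ xs) = trans (length-segment x (text xs)) (trans (sym (+-assoc m m _)) (cong (m + m +_) (length-text xs)))

  drop-segment : ∀ (x : Digits) rest t → drop (m + (m + t)) (block x ++ block (allZero K) ++ rest) ≡ drop t rest
  drop-segment x rest t = trans (drop-++-length (block x) (m + t) (length-block x))
                                (drop-++-length (block (allZero K)) t (length-block (allZero K)))

  module _ {q : ℕ} (q≤ : q ≤ K * suc s) where

    q≤code : ∀ (x : Digits) → q ≤ length (code x)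
    q≤code x = ≤-trans q≤ (≤-reflexive (sym (length-code x)))

    q≤block : ∀ (x : Digits) → q ≤ length (block x)
    q≤block x = ≤-trans (q≤code x) (length-++-≤ˡ (code x))

    q≤m : q ≤ m
    q≤m = ≤-trans (q≤block (allZero K)) (≤-reflexive (length-block (allZero K)))

    ones-window : ∀ (x : Digits) rest →
      ones (take m (drop q (block x ++ block (allZero K) ++ rest))) + ones (take q (code x))
        ≡ K + ones Z + ones (take q (code (allZero K)))
    ones-window x rest = begin
      ones (take m (drop q (block x ++ R))) + ones (take q (code x))
        ≡⟨ cong₂ (λ l p → ones (take l (drop q (block x ++ R))) + ones p) (length-block x) (take-++-≤ (code x) (q≤code x)) ⟨
      ones (take (length (block x)) (drop q (block x ++ R))) + ones (take q (block x))
        ≡⟨ ones-slide (block x) R (q≤block x) ⟩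
      ones (block x) + ones (take q R)
        ≡⟨ cong₂ _+_ (ones-block x) (cong ones reference-prefix) ⟩
      K + ones Z + ones (take q (code (allZero K)))
        ∎
      where
      open ≡-Reasoning
      R = block (allZero K) ++ rest
      reference-prefix : take q R ≡ take q (code (allZero K))
      reference-prefix = trans (take-++-≤ (block (allZero K)) (q≤block (allZero K)))
                               (take-++-≤ (code (allZero K)) (q≤code (allZero K)))

  _≺≺_ : ∀ {N} → Vec Digits N → Vec Digits N → Set
  _≺≺_ = Lex-< (Pointwise _≡_) _≺_

  separating-window : ∀ {N} {v w : Vec Digits N} → v ≺≺ w →
    ∃[ P ] (P + m ≤ length (text v) × ones (take m (drop P (text v))) ≡ K + ones Z
                                    × ones (take m (drop P (text w))) ≡ suc (K + ones Z))
  separating-window (this {x} {y} {xs = vs} {ws} x≺y _) with separating-prefix x≺y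
  ... | q , q≤ , same , one-less =
    q , fits ,
    +-cancelʳ-≡ _ _ _ (trans (ones-window q≤ x (text vs)) (cong (K + ones Z +_) (sym same))) ,
    +-cancelʳ-≡ _ _ _ (trans (ones-window q≤ y (text ws)) (trans (cong (K + ones Z +_) (sym one-less)) (+-suc _ _)))
    where
    fits : q + m ≤ length (text (x ∷ vs))
    fits = begin
      q + m                      ≤⟨ +-monoˡ-≤ m (q≤m q≤) ⟩
      m + m                      ≤⟨ +-monoʳ-≤ m (m≤m+n m _) ⟩
      m + (m + length (text vs)) ≡⟨ length-segment x (text vs) ⟨
      length (text (x ∷ vs))     ∎
      where open ≤-Reasoning
  separating-window (next {x} {xs = vs} {ws} x≋y rest) with Pointwise-≡⇒≡ x≋y | separating-window rest
  ... | refl | P , fits , ev , ew =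
    m + (m + P) , fits′ ,
    trans (cong (λ l → ones (take m l)) (drop-segment x (text vs) P)) ev ,
    trans (cong (λ l → ones (take m l)) (drop-segment x (text ws) P)) ew
    where
    fits′ : m + (m + P) + m ≤ length (text (x ∷ vs))
    fits′ = begin
      m + (m + P) + m            ≡⟨ trans (+-assoc m (m + P) m) (cong (m +_) (+-assoc m P m)) ⟩
      m + (m + (P + m))          ≤⟨ +-monoʳ-≤ m (+-monoʳ-≤ m fits) ⟩
      m + (m + length (text vs)) ≡⟨ length-segment x (text vs) ⟨
      length (text (x ∷ vs))     ∎
      where open ≤-Reasoning

  module _ {n N k : ℕ} (R : List Bool) (length-text++R : N * (m + m) + length R ≡ n) (k≡ : K + ones Z ≡ k) where

    hardText : Vec Digits N → Vec Bool n
    hardText v = Vec.cast length≡n (Vec.fromList (text v ++ R))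
      where
      length≡n : length (text v ++ R) ≡ n
      length≡n = trans (length-++ (text v)) (trans (cong (_+ length R) (length-text v)) length-text++R)

    toList-hardText : ∀ v → toList (hardText v) ≡ text v ++ R
    toList-hardText v = trans (toList-cast _ (Vec.fromList (text v ++ R))) (toList∘fromList (text v ++ R))

    separating-position : ∀ {v w} → v ≺≺ w → ∃[ i ] (InOcc m k (hardText v) i × ¬ InOcc m k (hardText w) i)
    separating-position {v} {w} v≺≺w with separating-window v≺≺w
    ... | P , fits , ones-v , ones-w =
      i , ones≤⇒InOcc m k (hardText v) i i+m≤n (≤-reflexive (trans (window v) (trans ones-v k≡))) ,
      λ occ → <⇒≱ (≤-reflexive (sym (trans (window w) (trans ones-w (cong suc k≡)))))
                  (InOcc⇒ones≤ m k (hardText w) i occ)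
      where
      fits′ : ∀ u → P + m ≤ length (text u)
      fits′ u = ≤-trans fits (≤-reflexive (trans (length-text v) (sym (length-text u))))
      P+m≤n : P + m ≤ n
      P+m≤n = ≤-trans fits (≤-trans (≤-reflexive (length-text v))
                                     (≤-trans (m≤m+n _ (length R)) (≤-reflexive length-text++R)))
      i : Fin (suc n)
      i = Fin.fromℕ< (s≤s (m+n≤o⇒m≤o P P+m≤n))
      toℕ-i : toℕ i ≡ P
      toℕ-i = Fin.toℕ-fromℕ< _
      i+m≤n : toℕ i + m ≤ n
      i+m≤n = ≤-trans (≤-reflexive (cong (_+ m) toℕ-i)) P+m≤n
      window : ∀ u → ones (take m (drop (toℕ i) (toList (hardText u)))) ≡ ones (take m (drop P (text u)))
      window u = cong ones (trans (cong₂ (λ p l → take m (drop p l)) toℕ-i (toList-hardText u))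
                                  (take-drop-++-≤ (text u) (fits′ u)))

    ≺≺-cmp : ∀ (v w : Vec Digits N) → Tri (v ≺≺ w) (Pointwise (Pointwise _≡_) v w) (w ≺≺ v)
    ≺≺-cmp = Lex.<-cmp (Pointwise.sym sym) (Lex.<-cmp sym Fin.<-cmp)

    message-hardText-injective : (Π : Protocol n m k) → Injective _≡_ _≡_ (message Π ∘ hardText)
    message-hardText-injective Π {v} {w} same with ≺≺-cmp v w
    ... | tri< v≺≺w _ _ = contradiction same (Occ-separated⇒message≢ Π (separating-position v≺≺w))
    ... | tri≈ _ v≋w _  = Pointwise-≡⇒≡ (Pointwise.map Pointwise-≡⇒≡ v≋w)
    ... | tri> _ _ w≺≺v = contradiction (sym same) (Occ-separated⇒message≢ Π (separating-position w≺≺v))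

    long-message : ∀ e → 2 ^ e ≡ suc s → (Π : Protocol n m k) → ∃[ T ] e * (N * K) ≤ length (message Π T)
    long-message e 2^e≡ Π =
      let i , long = injective⇒long-word (e * (N * K)) F F-injective 2^eNK≤
      in  hardText (digitMatrix N K i) , long
      where
      F : Fin (suc s ^ (N * K)) → List Bool
      F = message Π ∘ hardText ∘ digitMatrix N K
      F-injective : Injective _≡_ _≡_ F
      F-injective same = digitMatrix-injective N K (message-hardText-injective Π same)
      2^eNK≤ : 2 ^ (e * (N * K)) ≤ suc s ^ (N * K)
      2^eNK≤ = ≤-reflexive (trans (sym (^-*-assoc 2 e (N * K))) (cong (_^ (N * K)) 2^e≡))

[m*n]^o≡m^o*n^o : ∀ m n o → (m * n) ^ o ≡ m ^ o * n ^ o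
[m*n]^o≡m^o*n^o m n zero    = refl
[m*n]^o≡m^o*n^o m n (suc o) = trans (cong (m * n *_) ([m*n]^o≡m^o*n^o m n o)) (interchange m n (m ^ o) (n ^ o))

bernoulli : ∀ x h r → h + r ≡ suc x → suc x ^ h * r ≤ x ^ h * suc x
bernoulli x zero    r h+r≡ = ≤-reflexive (trans (*-identityˡ r) (trans h+r≡ (sym (*-identityˡ (suc x)))))
bernoulli x (suc h) r h+r≡ = begin
  suc x ^ suc h * r         ≡⟨ xy∙z≈y∙xz (suc x) (suc x ^ h) r ⟩
  suc x ^ h * (suc x * r)   ≤⟨ *-monoʳ-≤ (suc x ^ h) sx*r≤x*sr ⟩
  suc x ^ h * (x * suc r)   ≡⟨ x∙yz≈y∙xz (suc x ^ h) x (suc r) ⟩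
  x * (suc x ^ h * suc r)   ≤⟨ *-monoʳ-≤ x (bernoulli x h (suc r) (trans (+-suc h r) h+r≡)) ⟩
  x * (x ^ h * suc x)       ≡⟨ *-assoc x (x ^ h) (suc x) ⟨
  x ^ suc h * suc x         ∎
  where
  open ≤-Reasoning
  r≤x : r ≤ x
  r≤x = s≤s⁻¹ (≤-trans (s≤s (m≤n+m r h)) (≤-reflexive h+r≡))
  sx*r≤x*sr : suc x * r ≤ x * suc r
  sx*r≤x*sr = begin
    r + x * r   ≤⟨ +-monoˡ-≤ (x * r) r≤x ⟩
    x + x * r   ≡⟨ *-suc x r ⟨
    x * suc r   ∎

[1+x]^h≤2*x^h : ∀ x h → h + h ≤ suc x → suc x ^ h ≤ 2 * x ^ h
[1+x]^h≤2*x^h x h 2h≤ = *-cancelʳ-≤ _ _ (suc x) (begin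
  suc x ^ h * suc x         ≤⟨ *-monoʳ-≤ (suc x ^ h) sx≤2r ⟩
  suc x ^ h * (2 * r)       ≡⟨ x∙yz≈y∙xz (suc x ^ h) 2 r ⟩
  2 * (suc x ^ h * r)       ≤⟨ *-monoʳ-≤ 2 (bernoulli x h r h+r≡) ⟩
  2 * (x ^ h * suc x)       ≡⟨ *-assoc 2 (x ^ h) (suc x) ⟨
  2 * x ^ h * suc x         ∎)
  where
  open ≤-Reasoning
  r = suc x ∸ h
  h+r≡ : h + r ≡ suc x
  h+r≡ = m+[n∸m]≡n (m+n≤o⇒m≤o h 2h≤)
  sx≤2r : suc x ≤ 2 * r
  sx≤2r = begin
    suc x       ≡⟨ h+r≡ ⟨
    h + r       ≤⟨ +-monoˡ-≤ r (+-cancelˡ-≤ h h r (≤-trans 2h≤ (≤-reflexive (sym h+r≡)))) ⟩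
    r + r       ≡⟨ cong (r +_) (+-identityʳ r) ⟨
    2 * r       ∎

⌊n/2⌋+⌊n/2⌋≤n : ∀ n → ⌊ n /2⌋ + ⌊ n /2⌋ ≤ n
⌊n/2⌋+⌊n/2⌋≤n n = ≤-trans (+-monoʳ-≤ ⌊ n /2⌋ (⌊n/2⌋≤⌈n/2⌉ n)) (≤-reflexive (⌊n/2⌋+⌈n/2⌉≡n n))

[1+x]^k≤4*x^k : ∀ x k → k ≤ x → suc x ^ k ≤ 4 * x ^ k
[1+x]^k≤4*x^k x k k≤x = begin
  suc x ^ k                               ≡⟨ cong (suc x ^_) (⌊n/2⌋+⌈n/2⌉≡n k) ⟨
  suc x ^ (⌊ k /2⌋ + ⌈ k /2⌉)             ≡⟨ ^-distribˡ-+-* (suc x) ⌊ k /2⌋ ⌈ k /2⌉ ⟩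
  suc x ^ ⌊ k /2⌋ * suc x ^ ⌈ k /2⌉       ≤⟨ *-mono-≤ ([1+x]^h≤2*x^h x ⌊ k /2⌋ ⌊k/2⌋-fits)
                                                      ([1+x]^h≤2*x^h x ⌈ k /2⌉ ⌈k/2⌉-fits) ⟩
  (2 * x ^ ⌊ k /2⌋) * (2 * x ^ ⌈ k /2⌉)   ≡⟨ interchange 2 (x ^ ⌊ k /2⌋) 2 (x ^ ⌈ k /2⌉) ⟩
  4 * (x ^ ⌊ k /2⌋ * x ^ ⌈ k /2⌉)         ≡⟨ cong (4 *_) (^-distribˡ-+-* x ⌊ k /2⌋ ⌈ k /2⌉) ⟨
  4 * x ^ (⌊ k /2⌋ + ⌈ k /2⌉)             ≡⟨ cong (λ l → 4 * x ^ l) (⌊n/2⌋+⌈n/2⌉≡n k) ⟩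
  4 * x ^ k                               ∎
  where
  open ≤-Reasoning
  ⌊k/2⌋-fits : ⌊ k /2⌋ + ⌊ k /2⌋ ≤ suc x
  ⌊k/2⌋-fits = ≤-trans (⌊n/2⌋+⌊n/2⌋≤n k) (≤-trans k≤x (n≤1+n x))
  ⌈k/2⌉-fits : ⌈ k /2⌉ + ⌈ k /2⌉ ≤ suc x
  ⌈k/2⌉-fits = ≤-trans (⌊n/2⌋+⌊n/2⌋≤n (suc k)) (s≤s k≤x)

[k+g]^k≤k^k*4^g : ∀ k g → (k + g) ^ k ≤ k ^ k * 4 ^ g
[k+g]^k≤k^k*4^g k zero    = ≤-reflexive (trans (cong (_^ k) (+-identityʳ k)) (sym (*-identityʳ (k ^ k))))
[k+g]^k≤k^k*4^g k (suc g) = begin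
  (k + suc g) ^ k         ≡⟨ cong (_^ k) (+-suc k g) ⟩
  suc (k + g) ^ k         ≤⟨ [1+x]^k≤4*x^k (k + g) k (m≤m+n k g) ⟩
  4 * (k + g) ^ k         ≤⟨ *-monoʳ-≤ 4 ([k+g]^k≤k^k*4^g k g) ⟩
  4 * (k ^ k * 4 ^ g)     ≡⟨ x∙yz≈y∙xz 4 (k ^ k) (4 ^ g) ⟩
  k ^ k * 4 ^ suc g       ∎
  where open ≤-Reasoning

2^[e+e]≡4^e : ∀ e → 2 ^ (e + e) ≡ 4 ^ e
2^[e+e]≡4^e e = trans (cong (λ x → 2 ^ (e + x)) (sym (+-identityʳ e))) (sym (^-*-assoc 2 2 e))

binade : ∀ {k} .{{_ : NonZero k}} t → ∃[ e ] (k * 2 ^ e ≤ k + t × k + t < k * 2 ^ suc e)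
binade {k} zero = 0 , ≤-reflexive (trans (*-identityʳ k) (sym (+-identityʳ k))) ,
  ≤-trans (≤-reflexive (cong suc (trans (+-identityʳ k) (sym (*-identityʳ k))))) (*-monoʳ-< k (n<1+n 1))
binade {k} (suc t) with binade t
... | e , lo , hi with k + suc t <? k * 2 ^ suc e
...   | yes hi′ = e , ≤-trans lo (+-monoʳ-≤ k (n≤1+n t)) , hi′
...   | no ¬hi′ = suc e , ≮⇒≥ ¬hi′ , (begin-strict
  k + suc t                ≡⟨ +-suc k t ⟩
  suc (k + t)              ≤⟨ hi ⟩
  k * 2 ^ suc e            <⟨ *-monoʳ-< k (^-monoʳ-< 2 (n<1+n 1) (n<1+n (suc e))) ⟩
  k * 2 ^ suc (suc e)      ∎)
  where open ≤-Reasoning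

-- Parameters of the hard texts: K digits of e bits per block, padded by k − K ones.
record Admissible (k m : ℕ) : Set where
  field
    e K    : ℕ
    K≤k    : K ≤ k
    fits   : K * 2 ^ e + (k ∸ K) ≤ m
    bound  : m ^ k ≤ k ^ k * 4 ^ (e * K)

admissible-wide : ∀ {k m} .{{_ : NonZero k}} → k + k ≤ m → Admissible k m
admissible-wide {k} 2k≤m with m≤n⇒∃[o]m+o≡n (m+n≤o⇒m≤o k 2k≤m)
... | t , refl with binade {k} t
...   | zero , _ , hi = contradiction 2k≤m (<⇒≱ (<-≤-trans hi (≤-reflexive k*2≡k+k)))
  where
  k*2≡k+k : k * 2 ≡ k + k
  k*2≡k+k = trans (*-comm k 2) (cong (k +_) (+-identityʳ k))
...   | suc e , lo , hi = record { e = suc e ; K = k ; K≤k = ≤-refl ; fits = fits′ ; bound = bound′ }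
  where
  open ≤-Reasoning
  fits′ : k * 2 ^ suc e + (k ∸ k) ≤ k + t
  fits′ = begin
    k * 2 ^ suc e + (k ∸ k) ≡⟨ trans (cong (k * 2 ^ suc e +_) (n∸n≡0 k)) (+-identityʳ _) ⟩
    k * 2 ^ suc e           ≤⟨ lo ⟩
    k + t                   ∎
  k+t≤k*4^e : k + t ≤ k * 4 ^ suc e
  k+t≤k*4^e = begin
    k + t                      ≤⟨ <⇒≤ hi ⟩
    k * 2 ^ suc (suc e)        ≤⟨ *-monoʳ-≤ k (^-monoʳ-≤ 2 (s≤s (m≤n+m (suc e) e))) ⟩
    k * 2 ^ (suc e + suc e)    ≡⟨ cong (k *_) (2^[e+e]≡4^e (suc e)) ⟩
    k * 4 ^ suc e              ∎
  bound′ : (k + t) ^ k ≤ k ^ k * 4 ^ (suc e * k)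
  bound′ = begin
    (k + t) ^ k                ≤⟨ ^-monoˡ-≤ k k+t≤k*4^e ⟩
    (k * 4 ^ suc e) ^ k        ≡⟨ [m*n]^o≡m^o*n^o k (4 ^ suc e) k ⟩
    k ^ k * (4 ^ suc e) ^ k    ≡⟨ cong (k ^ k *_) (^-*-assoc 4 (suc e) k) ⟩
    k ^ k * 4 ^ (suc e * k)    ∎

admissible-narrow : ∀ {k m} → k ≤ m → m ≤ k + k → Admissible k m
admissible-narrow {k} k≤m m≤2k with m≤n⇒∃[o]m+o≡n k≤m
... | g , refl = record { e = 1 ; K = g ; K≤k = +-cancelˡ-≤ k g k m≤2k ; fits = ≤-reflexive fits′ ; bound = bound′ }
  where
  fits′ : g * 2 ^ 1 + (k ∸ g) ≡ k + g
  fits′ = begin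
    g * 2 + (k ∸ g)     ≡⟨ cong (_+ (k ∸ g)) (trans (*-comm g 2) (cong (g +_) (+-identityʳ g))) ⟩
    g + g + (k ∸ g)     ≡⟨ +-assoc g g (k ∸ g) ⟩
    g + (g + (k ∸ g))   ≡⟨ cong (g +_) (m+[n∸m]≡n (+-cancelˡ-≤ k g k m≤2k)) ⟩
    g + k               ≡⟨ +-comm g k ⟩
    k + g               ∎
    where open ≡-Reasoning
  bound′ : (k + g) ^ k ≤ k ^ k * 4 ^ (1 * g)
  bound′ = ≤-trans ([k+g]^k≤k^k*4^g k g) (≤-reflexive (cong (λ x → k ^ k * 4 ^ x) (sym (*-identityˡ g))))

admissible : ∀ {k m} → 0 < k → k < m → Admissible k m
admissible {k} {m} 0<k k<m with k + k ≤? m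
... | yes 2k≤m = admissible-wide {{>-nonZero 0<k}} 2k≤m
... | no  2k≰m = admissible-narrow (<⇒≤ k<m) (<⇒≤ (≰⇒> 2k≰m))

segment-count : ∀ {n d} .{{_ : NonZero d}} → d ≤ n → ∃[ N ] (N * d ≤ n × n ≤ 2 * N * d)
segment-count {n} {d} d≤n = n / d , m/n*n≤m n d , (begin
  n                      ≡⟨ m≡m%n+[m/n]*n n d ⟩
  n % d + n / d * d      ≤⟨ +-monoˡ-≤ (n / d * d) (<⇒≤ (m%n<n n d)) ⟩
  d + n / d * d          ≤⟨ +-monoˡ-≤ (n / d * d) d≤[n/d]*d ⟩
  n / d * d + n / d * d  ≡⟨ trans (*-assoc 2 (n / d) d) (cong (n / d * d +_) (+-identityʳ (n / d * d))) ⟨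
  2 * (n / d) * d        ∎)
  where
  open ≤-Reasoning
  d≤[n/d]*d : d ≤ n / d * d
  d≤[n/d]*d = ≤-trans (≤-reflexive (sym (*-identityˡ d))) (*-monoˡ-≤ d (m≥n⇒m/n>0 d≤n))

power-bound : ∀ {m k n N ℓ} e K → m ^ k ≤ k ^ k * 4 ^ (e * K) → n ≤ 2 * N * (2 * m) → e * (N * K) ≤ ℓ →
              m ^ (n * k) ≤ k ^ (n * k) * 2 ^ (8 * m * ℓ)
power-bound {m} {k} {n} {N} {ℓ} e K m^k≤ n≤ eNK≤ℓ = begin
  m ^ (n * k)                            ≡⟨ trans (cong (m ^_) (*-comm n k)) (sym (^-*-assoc m k n)) ⟩
  (m ^ k) ^ n                            ≤⟨ ^-monoˡ-≤ n m^k≤ ⟩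
  (k ^ k * 4 ^ (e * K)) ^ n              ≡⟨ [m*n]^o≡m^o*n^o (k ^ k) (4 ^ (e * K)) n ⟩
  (k ^ k) ^ n * (4 ^ (e * K)) ^ n        ≡⟨ cong₂ _*_ (trans (^-*-assoc k k n) (cong (k ^_) (*-comm k n))) (^-*-assoc 4 (e * K) n) ⟩
  k ^ (n * k) * 4 ^ (e * K * n)          ≡⟨ cong (k ^ (n * k) *_) (^-*-assoc 2 2 (e * K * n)) ⟩
  k ^ (n * k) * 2 ^ (2 * (e * K * n))    ≤⟨ *-monoʳ-≤ (k ^ (n * k)) (^-monoʳ-≤ 2 exponent) ⟩
  k ^ (n * k) * 2 ^ (8 * m * ℓ)          ∎
  where
  open ≤-Reasoning
  exponent : 2 * (e * K * n) ≤ 8 * m * ℓ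
  exponent = begin
    2 * (e * K * n)                      ≤⟨ *-monoʳ-≤ 2 (*-monoʳ-≤ (e * K) n≤) ⟩
    2 * (e * K * (2 * N * (2 * m)))      ≡⟨ rearrange e K N m ⟩
    8 * m * (e * (N * K))                ≤⟨ *-monoʳ-≤ (8 * m) eNK≤ℓ ⟩
    8 * m * ℓ                            ∎
    where
    rearrange : ∀ e K N m → 2 * (e * K * (2 * N * (2 * m))) ≡ 8 * m * (e * (N * K))
    rearrange = solve-∀

hard-instance : ∀ {n m k} N e K → K ≤ k → K * 2 ^ e + (k ∸ K) ≤ m → N * (2 * m) ≤ n →
                (Π : Protocol n m k) → ∃[ T ] e * (N * K) ≤ length (message Π T)
hard-instance {n} {m} {k} N e K K≤k fits N≤ Π =
  HardTexts.long-message Z length-block≡m {N = N} R length-text++R K+ones≡k e (sym (suc-pred (2 ^ e))) Π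
  where
  instance
    2^e≢0 : NonZero (2 ^ e)
    2^e≢0 = m^n≢0 2 e
  padding : ℕ
  padding = m ∸ (K * 2 ^ e + (k ∸ K))
  Z : List Bool
  Z = replicate (k ∸ K) true ++ zeros padding
  length-block≡m : K * suc (pred (2 ^ e)) + length Z ≡ m
  length-block≡m = begin
    K * suc (pred (2 ^ e)) + length Z ≡⟨ cong₂ (λ a b → K * a + b) (suc-pred (2 ^ e)) (length-ones++zeros (k ∸ K) padding) ⟩
    K * 2 ^ e + ((k ∸ K) + padding)   ≡⟨ +-assoc (K * 2 ^ e) (k ∸ K) padding ⟨
    K * 2 ^ e + (k ∸ K) + padding     ≡⟨ m+[n∸m]≡n fits ⟩
    m                                 ∎
    where open ≡-Reasoning
  K+ones≡k : K + ones Z ≡ k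
  K+ones≡k = trans (cong (K +_) (ones-ones++zeros (k ∸ K) padding)) (m+[n∸m]≡n K≤k)
  R : List Bool
  R = zeros (n ∸ N * (m + m))
  length-text++R : N * (m + m) + length R ≡ n
  length-text++R = trans (cong (N * (m + m) +_) (length-replicate (n ∸ N * (m + m))))
                         (m+[n∸m]≡n (≤-trans (≤-reflexive (cong (λ x → N * (m + x)) (sym (+-identityʳ m)))) N≤))

theorem2 : ∃[ d ] (1 ≤ d × (∀ (n m k : ℕ) → 0 < k → k < m → 2 * m ≤ n →
    (Π : Protocol n m k) →
    ∃[ T ] (m ^ (n * k) ≤ k ^ (n * k) * 2 ^ (d * m * length (message Π T)))))
theorem2 = 8 , s≤s z≤n , lower-bound
  where
  lower-bound : ∀ (n m k : ℕ) → 0 < k → k < m → 2 * m ≤ n → (Π : Protocol n m k) →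
                ∃[ T ] (m ^ (n * k) ≤ k ^ (n * k) * 2 ^ (8 * m * length (message Π T)))
  -- Matching m against suc provides NonZero (2 * m); m = 0 is refuted by k < m.
  lower-bound n m@(suc _) k 0<k k<m 2m≤n Π =
    let open Admissible (admissible 0<k k<m)
        N , N≤ , ≤N = segment-count 2m≤n
        T , long    = hard-instance N e K K≤k fits N≤ Π
    in  T , power-bound {N = N} e K bound ≤N long
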